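{- Let $n\ge 3$ and let $L^B$ be a blow-up of the Boolean lattice $L\cong\mathbf{2}^n$. Then $\operatorname{sdim}_M(G^c(L^B))=|Z^*(L^B)|-2^{n-1}+1$.
   Context: Blow-up: let $L=\mathbf{2}^n$. A blow-up $L^B$ is obtained by replacing each $a\in L\setminus\{0,1\}$ by a finite nonempty chain $C_a$ (possibly a single element), keeping $0,1$; order: $x\le y$ iff $x=0$, or $y=1$, or $x,y$ lie in the same chain $C_a$ with $x\le y$ there, or $x\in C_a$, $y\in C_b$ with $a<b$ in $L$; this is a lattice. For a lattice $M$ with $0$: $Z^*(M)$ is the set of nonzero $a$ with $a\wedge b=0$ for some $b\ne0$; $G^c(M)$ is the graph on $Z^*(M)$ with distinct $a,b$ adjacent iff $a\wedge b\neq 0$. In a connected graph $G$, a vertex $w$ strongly resolves $u,v$ if some shortest $u$–$w$ path contains $v$ or some shortest $v$–$w$ path contains $u$; $W\subseteq V(G)$ is a strong resolving set if every pair of distinct vertices is strongly resolved by some vertex in $W$; $\operatorname{sdim}_M(G)$ is the minimum size of a strong resolving set. -}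

module Defs where

open import Data.Nat using (ℕ; zero; suc; _≤_; _+_)
open import Data.Fin using (Fin; toℕ)
open import Data.Bool using (Bool; T; not; _∧_)
import Data.Bool.Properties as BoolP
open import Data.Vec.Properties using (≡-dec)
open import Data.Fin.Subset using (Subset; _⊆_) renaming (⊥ to ∅; ⊤ to full)
open import Data.Product using (Σ; ∃; _×_; _,_)
open import Data.Sum using (_⊎_)
open import Data.List using (List; length)
open import Data.List.Membership.Propositional using (_∈_)
open import Data.List.Relation.Unary.All using (All)
open import Data.List.Relation.Unary.Unique.Propositional using (Unique)
open import Relation.Binary.PropositionalEquality using (_≡_; _≢_)
open import Relation.Nullary using (¬_; Dec)
open import Relation.Nullary.Decidable using (⌊_⌋)
open import Function.Bundles using (_⇔_)

-- The Boolean lattice 2^n is represented by Subset n (subsets of Fin n,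
-- ordered by inclusion ⊆, bottom ∅, top full).

_≟S_ : ∀ {n} → (a b : Subset n) → Dec (a ≡ b)
_≟S_ = ≡-dec BoolP._≟_

isProper : ∀ {n} → Subset n → Bool
isProper {n} a = not ⌊ a ≟S ∅ ⌋ ∧ not ⌊ a ≟S full ⌋

_⊂_ : ∀ {n} → Subset n → Subset n → Set
a ⊂ b = a ⊆ b × a ≢ b

-- Blow-up L^B.  A blow-up is given by chain lengths k : Subset n → ℕ,
-- with k a ≥ 1 for each proper a (hypothesis of the theorem);
-- the chain C_a is Fin (k a) with its usual order.

data BU (n : ℕ) (k : Subset n → ℕ) : Set where
  bot : BU n k
  top : BU n k
  el  : (a : Subset n) → T (isProper a) → Fin (k a) → BU n k

IsBlowUp : (n : ℕ) → (Subset n → ℕ) → Set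
IsBlowUp n k = (a : Subset n) → T (isProper a) → 1 ≤ k a

module _ {n : ℕ} {k : Subset n → ℕ} where

  data _≤B_ : BU n k → BU n k → Set where
    bot≤  : ∀ {y} → bot ≤B y
    ≤top  : ∀ {x} → x ≤B top
    chain : ∀ {a p q} {i j : Fin (k a)} → toℕ i ≤ toℕ j → el a p i ≤B el a q j
    below : ∀ {a b p q} {i : Fin (k a)} {j : Fin (k b)} → a ⊂ b → el a p i ≤B el b q j

  MeetNonzero : BU n k → BU n k → Set
  MeetNonzero x y = ∃ λ z → z ≢ bot × z ≤B x × z ≤B y

  InZ : BU n k → Set
  InZ x = x ≢ bot × ∃ λ y → y ≢ bot × ¬ MeetNonzero x y

  Adj : BU n k → BU n k → Set
  Adj u v = InZ u × InZ v × u ≢ v × MeetNonzero u v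

  data Walk : BU n k → BU n k → Set where
    here : ∀ {u} → InZ u → Walk u u
    step : ∀ {u v w} → Adj u v → Walk v w → Walk u w

  len : ∀ {u w} → Walk u w → ℕ
  len (here _)   = 0
  len (step _ p) = suc (len p)

  data OnWalk (v : BU n k) : ∀ {u w} → Walk u w → Set where
    onHere : ∀ {z} {p : Walk v z} → OnWalk v {v} {z} p
    onThere : ∀ {u x w} {a : Adj u x} {p : Walk x w} → OnWalk v p → OnWalk v (step a p)

  Shortest : ∀ {u w} → Walk u w → Set
  Shortest {u} {w} p = (q : Walk u w) → len p ≤ len q

  StronglyResolves : BU n k → BU n k → BU n k → Set
  StronglyResolves w u v =
    (Σ (Walk u w) λ p → Shortest p × OnWalk v p) ⊎
    (Σ (Walk v w) λ p → Shortest p × OnWalk u p)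

  StrongResolvingSet : List (BU n k) → Set
  StrongResolvingSet W =
    Unique W × All InZ W ×
    ((u v : BU n k) → InZ u → InZ v → u ≢ v →
       ∃ λ w → w ∈ W × StronglyResolves w u v)

  IsSdim : ℕ → Set
  IsSdim m =
    (∃ λ W → StrongResolvingSet W × length W ≡ m) ×
    ((W : List (BU n k)) → StrongResolvingSet W → m ≤ length W)

  -- Zs is a duplicate-free enumeration of Z*(L^B), so |Z*(L^B)| = length Zs
  Enumerates : List (BU n k) → Set
  Enumerates Zs = Unique Zs × ((x : BU n k) → x ∈ Zs ⇔ InZ x)

{-# OPTIONS --safe #-}
-- The vertices of G^c(L^B) are the elements of the chains C_a, two of them adjacent iff their
-- supports a, b ⊆ {0, …, n-1} meet; for n ≥ 3 any two vertices have a common neighbour, so the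
-- graph has diameter 2. Vertices with equal supports are twins and vertices with complementary
-- supports are non-adjacent, so in both cases they are mutually maximally distant and only they
-- themselves can strongly resolve each other. Hence a strong resolving set misses at most one
-- vertex of each of the 2^(n-1) - 1 classes C_a ∪ C_∁a. Conversely, removing the bottom of C_a
-- for every a ∋ 0 leaves a strong resolving set: two removed vertices with supports a ≠ b are
-- resolved by the atom {x} for some x ∈ b ∖ a, through the geodesic a – b – {x}.
module Submission where

open import Defs
open import Data.Nat using (ℕ; zero; suc; _≤_; _<_; _+_; _∸_; _^_; z≤n; s≤s)
open import Data.Nat.Properties
  using (≤-refl; ≤-trans; ≤-antisym; <-trans; <⇒≱; n<1+n; +-comm; +-identityʳ; +-cancelʳ-≤;
         m+n∸n≡m; suc-injective; module ≤-Reasoning)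
open import Data.Bool using (T; not)
open import Data.Bool.Properties using (T-∧; T-irrelevant)
open import Data.Fin using (Fin; zero; suc; toℕ; fromℕ<)
import Data.Fin as Fin
open import Data.Fin.Properties using (toℕ-fromℕ<)
open import Data.Fin.Subset
  using (Subset; inside; outside; _∈_; _∉_; _⊆_; _∩_; ∁; ⁅_⁆; Nonempty)
  renaming (⊥ to ∅; ⊤ to full)
open import Data.Fin.Subset.Properties
  using (∉⊥; ∈⊤; ⊥⊆; drop-there; nonempty?; Empty-unique; x∈⁅x⁆; x∈⁅y⁆⇒x≡y; x≢y⇒x∉⁅y⁆;
         x∈p⇒x∉∁p; x∈∁p⇒x∉p; x∉p⇒x∈∁p; x∈p∩q⁺; x∈p∩q⁻; p∩q⊆p; p∩q⊆q; ∩-inverseʳ;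
         ∪-∩-booleanAlgebra)
import Algebra.Lattice.Properties.BooleanAlgebra as BooleanAlgebra
open import Data.Vec using ([]; _∷_; here; there)
open import Data.Vec.Properties using (∷-injectiveʳ)
open import Data.List using (List; []; _∷_; [_]; length; map; _++_; filter)
open import Data.List.Properties using (length-++; length-map; length-removeAt′)
open import Data.List.Relation.Unary.Any using (here; there; _─_)
import Data.List.Relation.Unary.All as All
open import Data.List.Relation.Unary.AllPairs using ([]; _∷_)
open import Data.List.Relation.Unary.Unique.Propositional using (Unique)
import Data.List.Relation.Unary.Unique.Propositional.Properties as Unique
open import Data.List.Membership.Propositional using () renaming (_∈_ to _∈ₗ_; _∉_ to _∉ₗ_)
open import Data.List.Membership.Propositional.Properties
  using (∈-map⁺; ∈-map⁻; ∈-++⁺ˡ; ∈-++⁺ʳ; ∈-++⁻; ∈-filter⁺; ∈-filter⁻; ∈-length)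
open import Data.Product using (Σ; ∃; _×_; _,_; proj₁; proj₂)
open import Data.Sum using (_⊎_; inj₁; inj₂; swap)
open import Data.Sum.Properties using (inj₁-injective; inj₂-injective)
open import Function using (_∘_; id; _⇔_; mk⇔; Equivalence)
open import Relation.Binary.Definitions using (DecidableEquality)
open import Relation.Binary.PropositionalEquality
  using (_≡_; _≢_; refl; sym; trans; cong; cong₂; subst; module ≡-Reasoning)
open import Relation.Nullary using (¬_; yes; no; contradiction; ¬?)
open import Relation.Nullary.Decidable using (⌊_⌋; fromWitnessFalse; toWitnessFalse)

private variable
  A B : Set
  n : ℕ
  a b : Subset n

allSubsets : ∀ n → List (Subset n)
allSubsets zero    = [ [] ]
allSubsets (suc n) = map (inside ∷_) (allSubsets n) ++ map (outside ∷_) (allSubsets n)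

∈-allSubsets : (a : Subset n) → a ∈ₗ allSubsets n
∈-allSubsets []            = here refl
∈-allSubsets (inside ∷ a)  = ∈-++⁺ˡ (∈-map⁺ (inside ∷_) (∈-allSubsets a))
∈-allSubsets (outside ∷ a) = ∈-++⁺ʳ _ (∈-map⁺ (outside ∷_) (∈-allSubsets a))

allSubsets-unique : ∀ n → Unique (allSubsets n)
allSubsets-unique zero    = All.[] ∷ []
allSubsets-unique (suc n) =
  Unique.++⁺ (Unique.map⁺ ∷-injectiveʳ (allSubsets-unique n))
             (Unique.map⁺ ∷-injectiveʳ (allSubsets-unique n))
             heads-differ
  where
  heads-differ : ¬ (a ∈ₗ map (inside ∷_) (allSubsets n) × a ∈ₗ map (outside ∷_) (allSubsets n))
  heads-differ (a∈ins , a∈outs) with ∈-map⁻ (inside ∷_) a∈ins | ∈-map⁻ (outside ∷_) a∈outs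
  ... | _ , _ , refl | _ , _ , ()

length-allSubsets : ∀ n → length (allSubsets n) ≡ 2 ^ n
length-allSubsets zero    = refl
length-allSubsets (suc n) = begin
  length (map (inside ∷_) as ++ map (outside ∷_) as)         ≡⟨ length-++ (map (inside ∷_) as) ⟩
  length (map (inside ∷_) as) + length (map (outside ∷_) as) ≡⟨ cong₂ _+_ (length-map _ as) (length-map _ as) ⟩
  length as + length as                                      ≡⟨ cong₂ _+_ ih (trans ih (sym (+-identityʳ _))) ⟩
  2 ^ n + (2 ^ n + 0)                                        ∎
  where
  open ≡-Reasoning
  as = allSubsets n
  ih = length-allSubsets n

≢∅⇒nonempty : a ≢ ∅ → Nonempty a
≢∅⇒nonempty {a = a} a≢∅ with nonempty? a
... | yes a≠∅ = a≠∅
... | no a=∅  = contradiction (Empty-unique a=∅) a≢∅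

≢full⇒∃∉ : a ≢ full → ∃ λ x → x ∉ a
≢full⇒∃∉ {a = []}          []≢[]  = contradiction refl []≢[]
≢full⇒∃∉ {a = outside ∷ a} _      = zero , λ ()
≢full⇒∃∉ {a = inside ∷ a}  a≢full =
  let x , x∉a = ≢full⇒∃∉ (a≢full ∘ cong (inside ∷_)) in suc x , x∉a ∘ drop-there

∈∧∉⇒≢ : ∀ {x y} → x ∈ a → y ∉ a → x ≢ y
∈∧∉⇒≢ x∈a y∉a refl = y∉a x∈a

Separated : Subset n → Subset n → Set
Separated a b = ∃ λ x → x ∈ b × x ∉ a ⊎ x ∈ a × x ∉ b

∷-separated : ∀ {s} → Separated a b → Separated (s ∷ a) (s ∷ b)
∷-separated (x , inj₁ (x∈b , x∉a)) = suc x , inj₁ (there x∈b , x∉a ∘ drop-there)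
∷-separated (x , inj₂ (x∈a , x∉b)) = suc x , inj₂ (there x∈a , x∉b ∘ drop-there)

≢⇒separated : a ≢ b → Separated a b
≢⇒separated {a = []}          {[]}          a≢b = contradiction refl a≢b
≢⇒separated {a = inside ∷ a}  {outside ∷ b} _   = zero , inj₂ (here , λ ())
≢⇒separated {a = outside ∷ a} {inside ∷ b}  _   = zero , inj₁ (here , λ ())
≢⇒separated {a = inside ∷ a}  {inside ∷ b}  a≢b = ∷-separated (≢⇒separated (a≢b ∘ cong (inside ∷_)))
≢⇒separated {a = outside ∷ a} {outside ∷ b} a≢b = ∷-separated (≢⇒separated (a≢b ∘ cong (outside ∷_)))

∁-involutive : (a : Subset n) → ∁ (∁ a) ≡ a
∁-involutive = BooleanAlgebra.¬-involutive (∪-∩-booleanAlgebra _)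

∁-injective : ∁ a ≡ ∁ b → a ≡ b
∁-injective {a = a} {b} ∁a≡∁b = trans (sym (∁-involutive a)) (trans (cong ∁ ∁a≡∁b) (∁-involutive b))

¬Nonempty[p∩∁p] : (a : Subset n) → ¬ Nonempty (a ∩ ∁ a)
¬Nonempty[p∩∁p] a (x , x∈a∩∁a) = ∉⊥ (subst (x ∈_) (∩-inverseʳ a) x∈a∩∁a)

proper⇔ : (a : Subset n) → T (isProper a) ⇔ (a ≢ ∅ × a ≢ full)
proper⇔ a = mk⇔
  (λ p → let p∅ , pfull = Equivalence.to T-∧′ p in toWitnessFalse p∅ , toWitnessFalse pfull)
  (λ (a≢∅ , a≢full) → Equivalence.from T-∧′ (fromWitnessFalse a≢∅ , fromWitnessFalse a≢full))
  where T-∧′ = T-∧ {not ⌊ a ≟S ∅ ⌋} {not ⌊ a ≟S full ⌋}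

proper⁺ : ∀ {x y} → x ∈ a → y ∉ a → T (isProper a)
proper⁺ {a = a} x∈a y∉a = Equivalence.from (proper⇔ a) ((λ { refl → ∉⊥ x∈a }) , (λ { refl → y∉a ∈⊤ }))

proper⇒nonempty : (a : Subset n) → T (isProper a) → Nonempty a
proper⇒nonempty a = ≢∅⇒nonempty ∘ proj₁ ∘ Equivalence.to (proper⇔ a)

proper⇒∃∉ : (a : Subset n) → T (isProper a) → ∃ λ x → x ∉ a
proper⇒∃∉ a = ≢full⇒∃∉ ∘ proj₂ ∘ Equivalence.to (proper⇔ a)

∁-proper : (a : Subset n) → T (isProper a) → T (isProper (∁ a))
∁-proper a p =
  let _ , x∈a = proper⇒nonempty a p
      _ , y∉a = proper⇒∃∉ a p
  in proper⁺ (x∉p⇒x∈∁p y∉a) (x∈p⇒x∉∁p x∈a)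

key : Subset (suc n) → Subset n
key (inside  ∷ a) = a
key (outside ∷ a) = ∁ a

key-≡ : key a ≡ key b → a ≡ b ⊎ ∁ a ≡ b
key-≡ {a = inside ∷ a}  {inside ∷ b}  a≡b   = inj₁ (cong (inside ∷_) a≡b)
key-≡ {a = outside ∷ a} {outside ∷ b} ∁a≡∁b = inj₁ (cong (outside ∷_) (∁-injective ∁a≡∁b))
key-≡ {a = inside ∷ a}  {outside ∷ b} a≡∁b  = inj₂ (cong (outside ∷_) (trans (cong ∁ a≡∁b) (∁-involutive b)))
key-≡ {a = outside ∷ a} {inside ∷ b}  ∁a≡b  = inj₂ (cong (inside ∷_) ∁a≡b)

key≢full : (a : Subset (suc n)) → T (isProper a) → key a ≢ full
key≢full (inside ∷ a)  p a≡full = proj₂ (Equivalence.to (proper⇔ _) p) (cong (inside ∷_) a≡full)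
key≢full (outside ∷ a) p ∁a≡full with proper⇒nonempty (outside ∷ a) p
... | suc x , there x∈a = x∈∁p⇒x∉p (subst (x ∈_) (sym ∁a≡full) ∈⊤) x∈a

∈-─⁺ : ∀ {x y} {ys : List A} (x∈ys : x ∈ₗ ys) → y ∈ₗ ys → y ≢ x → y ∈ₗ (ys ─ x∈ys)
∈-─⁺ (here refl)  (here refl)  y≢x = contradiction refl y≢x
∈-─⁺ (here refl)  (there y∈ys) _   = y∈ys
∈-─⁺ (there x∈ys) (here refl)  _   = here refl
∈-─⁺ (there x∈ys) (there y∈ys) y≢x = there (∈-─⁺ x∈ys y∈ys y≢x)

length-≤-injection : ∀ {xs ys} (f : A → B) → Unique xs →
  (∀ {x y} → x ∈ₗ xs → y ∈ₗ xs → f x ≡ f y → x ≡ y) →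
  (∀ {x} → x ∈ₗ xs → f x ∈ₗ ys) →
  length xs ≤ length ys
length-≤-injection {xs = []}     f _ _ _ = z≤n
length-≤-injection {xs = x ∷ xs} {ys} f (x∉xs ∷ xs-unique) inj maps = begin
  suc (length xs)           ≤⟨ s≤s (length-≤-injection f xs-unique inj′ maps′) ⟩
  suc (length (ys ─ fx∈ys)) ≡⟨ length-removeAt′ ys _ ⟨
  length ys                 ∎
  where
  open ≤-Reasoning
  fx∈ys = maps (here refl)
  inj′ : ∀ {y z} → y ∈ₗ xs → z ∈ₗ xs → f y ≡ f z → y ≡ z
  inj′ y∈xs z∈xs = inj (there y∈xs) (there z∈xs)
  maps′ : ∀ {y} → y ∈ₗ xs → f y ∈ₗ (ys ─ fx∈ys)
  maps′ y∈xs = ∈-─⁺ fx∈ys (maps (there y∈xs)) (All.lookup x∉xs y∈xs ∘ inj (here refl) (there y∈xs) ∘ sym)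

w+p≡1+z⇒z∸p+1≡w : ∀ {w p z} → 1 ≤ w → w + p ≡ suc z → z ∸ p + 1 ≡ w
w+p≡1+z⇒z∸p+1≡w {suc w} {p} {z} _ eq = begin
  z ∸ p + 1       ≡⟨ +-comm (z ∸ p) 1 ⟩
  suc (z ∸ p)     ≡⟨ cong (λ t → suc (t ∸ p)) (suc-injective eq) ⟨
  suc (w + p ∸ p) ≡⟨ cong suc (m+n∸n≡m w p) ⟩
  suc w           ∎
  where open ≡-Reasoning

-- The graph G^c(L^B) of an arbitrary blow-up

module BlowUp {n : ℕ} {k : Subset n → ℕ} (k≥1 : IsBlowUp n k) where

  private variable
    u v w x y z : BU n k

  supp : BU n k → Subset n
  supp bot        = ∅
  supp top        = full
  supp (el a _ _) = a

  least : (a : Subset n) → T (isProper a) → BU n k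
  least a p = el a p (fromℕ< (k≥1 a p))

  _≟_ : DecidableEquality (BU n k)
  bot      ≟ bot      = yes refl
  top      ≟ top      = yes refl
  el a p i ≟ el b q j with a ≟S b
  ... | no a≢b = no (a≢b ∘ cong supp)
  ... | yes refl with i Fin.≟ j
  ...   | no i≢j   = no λ { refl → i≢j refl }
  ...   | yes refl = yes (cong (λ p → el a p i) (T-irrelevant p q))
  bot      ≟ top      = no λ ()
  bot      ≟ el _ _ _ = no λ ()
  top      ≟ bot      = no λ ()
  top      ≟ el _ _ _ = no λ ()
  el _ _ _ ≟ bot      = no λ ()
  el _ _ _ ≟ top      = no λ ()

  ≤B-refl : x ≢ bot → x ≤B x
  ≤B-refl {bot}      x≢bot = contradiction refl x≢bot
  ≤B-refl {top}      _     = ≤top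
  ≤B-refl {el _ _ _} _     = chain ≤-refl

  supp-mono : x ≤B y → supp x ⊆ supp y
  supp-mono bot≤              = ⊥⊆
  supp-mono ≤top              = λ _ → ∈⊤
  supp-mono (chain _)         = id
  supp-mono (below (a⊆b , _)) = a⊆b

  least≤el : ∀ {c r a p i} → c ⊆ a → least c r ≤B el a p i
  least≤el {c} {r} {a} {i = i} c⊆a with c ≟S a
  ... | yes refl = chain (subst (_≤ toℕ i) (sym (toℕ-fromℕ< (k≥1 c r))) z≤n)
  ... | no c≢a   = below (c⊆a , c≢a)

  nonempty-below-el : ∀ {a p i} → z ≢ bot → z ≤B el a p i → Nonempty (supp z)
  nonempty-below-el z≢bot bot≤                  = contradiction refl z≢bot
  nonempty-below-el _     (chain {a} {p} _)     = proper⇒nonempty a p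
  nonempty-below-el _     (below {a} {p = p} _) = proper⇒nonempty a p

  meetNonzero⇒∩ : ∀ {a p i} → MeetNonzero (el a p i) y → Nonempty (a ∩ supp y)
  meetNonzero⇒∩ (z , z≢bot , z≤x , z≤y) =
    let x , x∈z = nonempty-below-el z≢bot z≤x
    in x , x∈p∩q⁺ (supp-mono z≤x x∈z , supp-mono z≤y x∈z)

  ∩⇒meetNonzero : ∀ {a p i b q j} → Nonempty (a ∩ b) → MeetNonzero (el a p i) (el b q j)
  ∩⇒meetNonzero {a} {p} {b = b} (x , x∈a∩b) =
    least (a ∩ b) a∩b-proper , (λ ()) , least≤el (p∩q⊆p a b) , least≤el (p∩q⊆q a b)
    where
    a∩b-proper : T (isProper (a ∩ b))
    a∩b-proper = let _ , y∉a = proper⇒∃∉ a p in proper⁺ x∈a∩b (y∉a ∘ p∩q⊆p a b)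

  ¬InZ-bot : ¬ InZ {n} {k} bot
  ¬InZ-bot (bot≢bot , _) = bot≢bot refl

  ¬InZ-top : ¬ InZ {n} {k} top
  ¬InZ-top (_ , y , y≢bot , ¬meet) = ¬meet (y , y≢bot , ≤top , ≤B-refl y≢bot)

  InZ-el : ∀ {a p i} → InZ (el a p i)
  InZ-el {a} {p} = (λ ()) , least (∁ a) (∁-proper a p) , (λ ()) , ¬Nonempty[p∩∁p] a ∘ meetNonzero⇒∩

  InZ⇒proper : InZ x → T (isProper (supp x))
  InZ⇒proper {bot}      zx = contradiction zx ¬InZ-bot
  InZ⇒proper {top}      zx = contradiction zx ¬InZ-top
  InZ⇒proper {el _ p _} _  = p

  Adj⇒InZʳ : Adj x y → InZ y
  Adj⇒InZʳ = proj₁ ∘ proj₂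

  Adj⇒∩ : Adj x y → Nonempty (supp x ∩ supp y)
  Adj⇒∩ {bot}      (zx , _)           = contradiction zx ¬InZ-bot
  Adj⇒∩ {top}      (zx , _)           = contradiction zx ¬InZ-top
  Adj⇒∩ {el _ _ _} (_ , _ , _ , meet) = meetNonzero⇒∩ meet

  Adj-intro : InZ x → InZ y → x ≢ y → Nonempty (supp x ∩ supp y) → Adj x y
  Adj-intro {el _ _ _} {el _ _ _} zx zy x≢y common = zx , zy , x≢y , ∩⇒meetNonzero common
  Adj-intro {bot}                 zx _  _   _      = contradiction zx ¬InZ-bot
  Adj-intro {top}                 zx _  _   _      = contradiction zx ¬InZ-top
  Adj-intro {el _ _ _} {bot}      _  zy _   _      = contradiction zy ¬InZ-bot
  Adj-intro {el _ _ _} {top}      _  zy _   _      = contradiction zy ¬InZ-top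

  len≥1 : u ≢ w → (P : Walk u w) → 1 ≤ len P
  len≥1 u≢u (here _)   = contradiction refl u≢u
  len≥1 _   (step _ _) = s≤s z≤n

  len≥2 : u ≢ w → ¬ Adj u w → (P : Walk u w) → 2 ≤ len P
  len≥2 u≢u _   (here _)            = contradiction refl u≢u
  len≥2 _   u≁w (step u~w (here _)) = contradiction u~w u≁w
  len≥2 _   _   (step _ (step _ _)) = s≤s (s≤s z≤n)

  InZ-end : Walk u w → InZ w
  InZ-end (here zw)  = zw
  InZ-end (step _ P) = InZ-end P

  on-end : (P : Walk u w) → OnWalk w P
  on-end (here _)   = onHere
  on-end (step _ P) = onThere (on-end P)

  suffix : {P : Walk u w} → OnWalk v P → v ≡ u ⊎ Σ (Walk v w) λ Q → len Q < len P
  suffix onHere = inj₁ refl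
  suffix (onThere {p = P} v∈P) with suffix v∈P
  ... | inj₁ refl      = inj₂ (P , ≤-refl)
  ... | inj₂ (Q , Q<P) = inj₂ (Q , <-trans Q<P (n<1+n _))

  -- The paper's "v is maximally distant from u" (no neighbour of v is farther from u than v),
  -- phrased through geodesics.
  MaxDistant : BU n k → BU n k → Set
  MaxDistant u v = ∀ {w} (P : Walk u w) → Shortest P → OnWalk v P → w ≡ v

  nbhd⊆⇒maxDistant : u ≢ v → (∀ {x} → Adj v x → x ≢ u → Adj u x) → MaxDistant u v
  nbhd⊆⇒maxDistant {u} u≢v nbhd P shortest v∈P with suffix v∈P
  ... | inj₁ v≡u                            = contradiction (sym v≡u) u≢v
  ... | inj₂ (here _ , _)                   = refl
  ... | inj₂ (step {v = x} v~x Q , Q′<P) with x ≟ u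
  ...   | yes refl = contradiction (shortest Q) (<⇒≱ (<-trans (n<1+n _) Q′<P))
  ...   | no x≢u   = contradiction (shortest (step (nbhd v~x x≢u) Q)) (<⇒≱ Q′<P)

  sameSupport⇒maxDistant : InZ u → u ≢ v → supp u ≡ supp v → MaxDistant u v
  sameSupport⇒maxDistant zu u≢v same = nbhd⊆⇒maxDistant u≢v λ v~x x≢u →
    Adj-intro zu (Adj⇒InZʳ v~x) (x≢u ∘ sym) (subst (λ a → Nonempty (a ∩ _)) (sym same) (Adj⇒∩ v~x))

  resolver-maxDistant : MaxDistant u v → MaxDistant v u → StronglyResolves w u v → w ≡ v ⊎ w ≡ u
  resolver-maxDistant uv _  (inj₁ (P , shortest , v∈P)) = inj₁ (uv P shortest v∈P)
  resolver-maxDistant _  vu (inj₂ (P , shortest , u∈P)) = inj₂ (vu P shortest u∈P)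

  resolves-beyond : Adj u v → Adj v w → u ≢ w → ¬ Adj u w → StronglyResolves w u v
  resolves-beyond u~v v~w u≢w u≁w =
    inj₁ (step u~v (step v~w (here (Adj⇒InZʳ v~w))) , len≥2 u≢w u≁w , onThere onHere)

-- Blow-ups of 2^n with n ≥ 3

module BlowUp≥3 {m : ℕ} {k : Subset (3 + m) → ℕ} (k≥1 : IsBlowUp (3 + m) k) where

  open BlowUp k≥1

  private variable
    u v w x y : BU (3 + m) k

  avoid₂ : (x y : Fin (3 + m)) → ∃ λ z → z ≢ x × z ≢ y
  avoid₂ zero          zero          = suc zero , (λ ()) , (λ ())
  avoid₂ zero          (suc zero)    = suc (suc zero) , (λ ()) , (λ ())
  avoid₂ zero          (suc (suc _)) = suc zero , (λ ()) , (λ ())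
  avoid₂ (suc zero)    zero          = suc (suc zero) , (λ ()) , (λ ())
  avoid₂ (suc (suc _)) zero          = suc zero , (λ ()) , (λ ())
  avoid₂ (suc _)       (suc _)       = zero , (λ ()) , (λ ())

  common-neighbour : InZ u → InZ w → ¬ Nonempty (supp u ∩ supp w) → ∃ λ c → Adj u c × Adj c w
  common-neighbour {u} {w} zu zw disjoint
    with proper⇒nonempty _ (InZ⇒proper zu) | proper⇒nonempty _ (InZ⇒proper zw)
  ... | x , x∈u | y , y∈w with avoid₂ x y
  ... | z , z≢x , z≢y =
    hub , Adj-intro zu InZ-el u≢hub (x , x∈p∩q⁺ (x∈u , x∈hub))
        , Adj-intro InZ-el zw hub≢w (y , x∈p∩q⁺ (y∈hub , y∈w))
    where
    x∈hub = x∉p⇒x∈∁p (x≢y⇒x∉⁅y⁆ (z≢x ∘ sym))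
    y∈hub = x∉p⇒x∈∁p (x≢y⇒x∉⁅y⁆ (z≢y ∘ sym))
    hub : BU (3 + m) k
    hub = least (∁ ⁅ z ⁆) (proper⁺ x∈hub (x∈p⇒x∉∁p (x∈⁅x⁆ z)))
    u≢hub : u ≢ hub
    u≢hub u≡hub = disjoint (y , x∈p∩q⁺ (subst (y ∈_) (cong supp (sym u≡hub)) y∈hub , y∈w))
    hub≢w : hub ≢ w
    hub≢w hub≡w = disjoint (x , x∈p∩q⁺ (x∈u , subst (x ∈_) (cong supp hub≡w) x∈hub))

  geodesic : InZ u → InZ w → Σ (Walk u w) λ P → Shortest P × len P ≤ 2
  geodesic {u} {w} zu zw with u ≟ w
  ... | yes refl = here zu , (λ _ → z≤n) , z≤n
  ... | no u≢w with nonempty? (supp u ∩ supp w)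
  ...   | yes common  = step (Adj-intro zu zw u≢w common) (here zw) , len≥1 u≢w , s≤s z≤n
  ...   | no disjoint =
    let _ , u~hub , hub~w = common-neighbour zu zw disjoint
    in step u~hub (step hub~w (here zw)) , len≥2 u≢w (disjoint ∘ Adj⇒∩) , ≤-refl

  resolves-self : InZ u → InZ v → StronglyResolves u u v
  resolves-self zu zv = let P , shortest , _ = geodesic zv zu in inj₂ (P , shortest , on-end P)

  len≥3 : u ≢ v → ¬ Adj u v → v ≢ w → (P : Walk u w) → OnWalk v P → 3 ≤ len P
  len≥3 u≢u _   _   _                            onHere                     = contradiction refl u≢u
  len≥3 _   u≁v _   (step u~v _)                 (onThere onHere)           = contradiction u~v u≁v
  len≥3 _   _   v≢v (step _ (step _ (here _)))   (onThere (onThere onHere)) = contradiction refl v≢v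
  len≥3 _   _   _   (step _ (step _ (step _ _))) (onThere (onThere _))      = s≤s (s≤s (s≤s z≤n))

  nonAdjacent⇒maxDistant : InZ u → u ≢ v → ¬ Adj u v → MaxDistant u v
  nonAdjacent⇒maxDistant {v = v} zu u≢v u≁v {w} P shortest v∈P with w ≟ v
  ... | yes w≡v = w≡v
  ... | no w≢v  =
    let Q , _ , Q≤2 = geodesic zu (InZ-end P)
    in contradiction (≤-trans (shortest Q) Q≤2) (<⇒≱ (len≥3 u≢v u≁v (w≢v ∘ sym) P v∈P))

  sameKey⇒maxDistant : InZ u → u ≢ v → key (supp u) ≡ key (supp v) → MaxDistant u v
  sameKey⇒maxDistant {u} {v} zu u≢v same-key with key-≡ same-key
  ... | inj₁ same = sameSupport⇒maxDistant zu u≢v same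
  ... | inj₂ ∁u≡v = nonAdjacent⇒maxDistant zu u≢v λ u~v →
    ¬Nonempty[p∩∁p] (supp u) (subst (λ b → Nonempty (supp u ∩ b)) (sym ∁u≡v) (Adj⇒∩ u~v))

  ⁅⁆-proper : (x : Fin (3 + m)) → T (isProper ⁅ x ⁆)
  ⁅⁆-proper x@zero    = proper⁺ (x∈⁅x⁆ x) (x≢y⇒x∉⁅y⁆ {x = suc zero} {y = x} λ ())
  ⁅⁆-proper x@(suc _) = proper⁺ (x∈⁅x⁆ x) (x≢y⇒x∉⁅y⁆ {x = zero} {y = x} λ ())

  atom : Fin (3 + m) → BU (3 + m) k
  atom x = least ⁅ x ⁆ (⁅⁆-proper x)

  atom-resolves : ∀ {c x} → InZ u → InZ v → c ∈ supp u → c ∈ supp v → x ∈ supp v → x ∉ supp u →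
                  StronglyResolves (atom x) u v
  atom-resolves {u} {v} {c} {x} zu zv c∈u c∈v x∈v x∉u = resolves-beyond
    (Adj-intro zu zv u≢v (c , x∈p∩q⁺ (c∈u , c∈v)))
    (Adj-intro zv InZ-el v≢atom (x , x∈p∩q⁺ (x∈v , x∈⁅x⁆ x)))
    u≢atom u≁atom
    where
    ∈⁅x⁆⇒∉u : ∀ {y} → y ∈ ⁅ x ⁆ → y ∉ supp u
    ∈⁅x⁆⇒∉u y∈⁅x⁆ = subst (_∉ supp u) (sym (x∈⁅y⁆⇒x≡y x y∈⁅x⁆)) x∉u
    u≢v : u ≢ v
    u≢v u≡v = x∉u (subst (λ t → x ∈ supp t) (sym u≡v) x∈v)
    v≢atom : v ≢ atom x
    v≢atom v≡atom = ∈⁅x⁆⇒∉u (subst (c ∈_) (cong supp v≡atom) c∈v) c∈u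
    u≢atom : u ≢ atom x
    u≢atom u≡atom = x∉u (subst (x ∈_) (cong supp (sym u≡atom)) (x∈⁅x⁆ x))
    u≁atom : ¬ Adj u (atom x)
    u≁atom u~atom = let y , y∈u∩⁅x⁆ = Adj⇒∩ u~atom
                        y∈u , y∈⁅x⁆ = x∈p∩q⁻ (supp u) ⁅ x ⁆ y∈u∩⁅x⁆
                    in ∈⁅x⁆⇒∉u y∈⁅x⁆ y∈u

  -- The key of a support names its class {a, ∁ a}; the class is represented by the bottom of the
  -- chain at its member containing 0. Adjoining top as representative of the class {∅, full}
  -- makes rep total and injective on all 2^(n-1) keys.
  rep : Subset (2 + m) → BU (3 + m) k
  rep s with s ≟S full
  ... | yes _     = top
  ... | no s≢full =
    let _ , y∉s = ≢full⇒∃∉ s≢full in least (inside ∷ s) (proper⁺ {a = inside ∷ s} here (y∉s ∘ drop-there))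

  supp-rep : ∀ s → supp (rep s) ≡ inside ∷ s
  supp-rep s with s ≟S full
  ... | yes refl = refl
  ... | no _     = refl

  rep-injective : ∀ {s t} → rep s ≡ rep t → s ≡ t
  rep-injective {s} {t} eq = ∷-injectiveʳ (trans (sym (supp-rep s)) (trans (cong supp eq) (supp-rep t)))

  rep≡top⊎InZ : ∀ s → rep s ≡ top ⊎ InZ (rep s)
  rep≡top⊎InZ s with s ≟S full
  ... | yes _ = inj₁ refl
  ... | no _  = inj₂ InZ-el

  IsRep : BU (3 + m) k → Set
  IsRep x = x ≡ rep (key (supp x))

  rep-IsRep : ∀ s → IsRep (rep s)
  rep-IsRep s = sym (cong (rep ∘ key) (supp-rep s))

  IsRep⇒0∈supp : IsRep x → zero ∈ supp x
  IsRep⇒0∈supp {x} x-rep = subst (zero ∈_) (sym (trans (cong supp x-rep) (supp-rep (key (supp x))))) here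

  IsRep-supp-injective : IsRep u → IsRep v → supp u ≡ supp v → u ≡ v
  IsRep-supp-injective u-rep v-rep same = trans u-rep (trans (cong (rep ∘ key) same) (sym v-rep))

  module Enumerated (Zs : List (BU (3 + m) k)) (enum : Enumerates Zs) where

    toZ : x ∈ₗ Zs → InZ x
    toZ = Equivalence.to (proj₂ enum _)

    fromZ : InZ x → x ∈ₗ Zs
    fromZ = Equivalence.from (proj₂ enum _)

    W : List (BU (3 + m) k)
    W = filter (λ x → ¬? (x ≟ rep (key (supp x)))) Zs

    ∈W⁺ : InZ x → ¬ IsRep x → x ∈ₗ W
    ∈W⁺ zx ¬rep = ∈-filter⁺ _ (fromZ zx) ¬rep

    ∈W⁻ : x ∈ₗ W → x ∈ₗ Zs × ¬ IsRep x
    ∈W⁻ = ∈-filter⁻ _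

    atom∈W : ∀ {x} → zero ≢ x → atom x ∈ₗ W
    atom∈W 0≢x = ∈W⁺ InZ-el (x≢y⇒x∉⁅y⁆ 0≢x ∘ IsRep⇒0∈supp)

    reps-resolved-by-atom : ∀ {x} → InZ u → InZ v → IsRep u → IsRep v → x ∈ supp v → x ∉ supp u →
                            ∃ λ w → w ∈ₗ W × StronglyResolves w u v
    reps-resolved-by-atom zu zv u-rep v-rep x∈v x∉u =
      atom _ , atom∈W (∈∧∉⇒≢ 0∈u x∉u) , atom-resolves zu zv 0∈u (IsRep⇒0∈supp v-rep) x∈v x∉u
      where 0∈u = IsRep⇒0∈supp u-rep

    reps-resolved : InZ u → InZ v → IsRep u → IsRep v → u ≢ v → ∃ λ w → w ∈ₗ W × StronglyResolves w u v
    reps-resolved zu zv u-rep v-rep u≢v with ≢⇒separated (u≢v ∘ IsRep-supp-injective u-rep v-rep)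
    ... | _ , inj₁ (x∈v , x∉u) = reps-resolved-by-atom zu zv u-rep v-rep x∈v x∉u
    ... | _ , inj₂ (x∈u , x∉v) =
      let w , w∈W , w-resolves = reps-resolved-by-atom zv zu v-rep u-rep x∈u x∉v in w , w∈W , swap w-resolves

    W-resolving : StrongResolvingSet W
    W-resolving = Unique.filter⁺ _ (proj₁ enum) , All.tabulate (toZ ∘ proj₁ ∘ ∈W⁻) , resolve
      where
      resolve : ∀ u v → InZ u → InZ v → u ≢ v → ∃ λ w → w ∈ₗ W × StronglyResolves w u v
      resolve u v zu zv u≢v with u ≟ rep (key (supp u)) | v ≟ rep (key (supp v))
      ... | no ¬u-rep | _         = u , ∈W⁺ zu ¬u-rep , resolves-self zu zv
      ... | yes _     | no ¬v-rep = v , ∈W⁺ zv ¬v-rep , swap (resolves-self zv zu)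
      ... | yes u-rep | yes v-rep = reps-resolved zu zv u-rep v-rep u≢v

    upper : length W + 2 ^ (2 + m) ≤ suc (length Zs)
    upper = begin
      length W + 2 ^ (2 + m)              ≡⟨ cong (length W +_) (length-allSubsets (2 + m)) ⟨
      length W + length keys              ≡⟨ cong (length W +_) (length-map rep keys) ⟨
      length W + length (map rep keys)    ≡⟨ length-++ W ⟨
      length (W ++ map rep keys)          ≤⟨ length-≤-injection id unique (λ _ _ → id) ⊆top∷Zs ⟩
      length (top ∷ Zs)                   ∎
      where
      open ≤-Reasoning
      keys = allSubsets (2 + m)
      unique : Unique (W ++ map rep keys)
      unique = Unique.++⁺ (Unique.filter⁺ _ (proj₁ enum)) (Unique.map⁺ rep-injective (allSubsets-unique _))
        λ (x∈W , x∈reps) → let s , _ , x≡rep = ∈-map⁻ rep x∈reps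
                           in proj₂ (∈W⁻ x∈W) (subst IsRep (sym x≡rep) (rep-IsRep s))
      ⊆top∷Zs : x ∈ₗ W ++ map rep keys → x ∈ₗ top ∷ Zs
      ⊆top∷Zs x∈ with ∈-++⁻ W x∈
      ... | inj₁ x∈W = there (proj₁ (∈W⁻ x∈W))
      ... | inj₂ x∈reps with ∈-map⁻ rep x∈reps
      ...   | s , _ , refl with rep≡top⊎InZ s
      ...     | inj₁ rep≡top = here rep≡top
      ...     | inj₂ rep∈Z   = there (fromZ rep∈Z)

    module _ {W′ : List (BU (3 + m) k)} (W′-resolving : StrongResolvingSet W′) where
      open import Data.List.Membership.DecPropositional _≟_ using (_∈?_)

      classify : BU (3 + m) k → BU (3 + m) k ⊎ Subset (2 + m)
      classify x with x ∈? W′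
      ... | yes _ = inj₁ x
      ... | no _  = inj₂ (key (supp x))

      classify-∈ : ∀ x → classify x ∈ₗ map inj₁ W′ ++ map inj₂ (allSubsets (2 + m))
      classify-∈ x with x ∈? W′
      ... | yes x∈W′ = ∈-++⁺ˡ (∈-map⁺ inj₁ x∈W′)
      ... | no _     = ∈-++⁺ʳ _ (∈-map⁺ inj₂ (∈-allSubsets _))

      sameKey-∉W′⇒≡ : x ∈ₗ top ∷ Zs → y ∈ₗ top ∷ Zs → x ∉ₗ W′ → y ∉ₗ W′ →
                          key (supp x) ≡ key (supp y) → x ≡ y
      sameKey-∉W′⇒≡ (here refl) (here refl) _ _ _ = refl
      sameKey-∉W′⇒≡ {y = y} (here refl) (there y∈Zs) _ _ eq =
        contradiction (sym eq) (key≢full (supp y) (InZ⇒proper (toZ y∈Zs)))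
      sameKey-∉W′⇒≡ {x} (there x∈Zs) (here refl) _ _ eq =
        contradiction eq (key≢full (supp x) (InZ⇒proper (toZ x∈Zs)))
      sameKey-∉W′⇒≡ {x} {y} (there x∈Zs) (there y∈Zs) x∉W′ y∉W′ eq with x ≟ y
      ... | yes x≡y = x≡y
      ... | no x≢y with proj₂ (proj₂ W′-resolving) x y (toZ x∈Zs) (toZ y∈Zs) x≢y
      ...   | w , w∈W′ , w-resolves
        with resolver-maxDistant (sameKey⇒maxDistant (toZ x∈Zs) x≢y eq)
                                 (sameKey⇒maxDistant (toZ y∈Zs) (x≢y ∘ sym) (sym eq)) w-resolves
      ...     | inj₁ refl = contradiction w∈W′ y∉W′
      ...     | inj₂ refl = contradiction w∈W′ x∉W′

      classify-injective : x ∈ₗ top ∷ Zs → y ∈ₗ top ∷ Zs → classify x ≡ classify y → x ≡ y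
      classify-injective {x} {y} x∈ y∈ eq with x ∈? W′ | y ∈? W′
      ... | yes _   | yes _   = inj₁-injective eq
      ... | no x∉W′ | no y∉W′ = sameKey-∉W′⇒≡ x∈ y∈ x∉W′ y∉W′ (inj₂-injective eq)
      ... | yes _   | no _    = contradiction eq λ ()
      ... | no _    | yes _   = contradiction eq λ ()

      lower : suc (length Zs) ≤ length W′ + 2 ^ (2 + m)
      lower = begin
        length (top ∷ Zs)                            ≤⟨ length-≤-injection classify (top∉Zs ∷ proj₁ enum)
                                                           classify-injective (λ _ → classify-∈ _) ⟩
        length (map inj₁ W′ ++ map inj₂ keys)         ≡⟨ length-++ (map inj₁ W′) ⟩
        length (map inj₁ W′) + length (map inj₂ keys) ≡⟨ cong₂ _+_ (length-map inj₁ W′)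
                                                           (trans (length-map inj₂ keys) (length-allSubsets (2 + m))) ⟩
        length W′ + 2 ^ (2 + m)                      ∎
        where
        open ≤-Reasoning
        keys = allSubsets (2 + m)
        top∉Zs : All.All (top ≢_) Zs
        top∉Zs = All.tabulate λ y∈Zs top≡y → ¬InZ-top (subst InZ (sym top≡y) (toZ y∈Zs))

    sdim : IsSdim (length Zs ∸ 2 ^ (2 + m) + 1)
    sdim = (W , W-resolving , sym |W|) , λ W′ W′-resolving →
      subst (_≤ length W′) (sym |W|) (+-cancelʳ-≤ _ _ _ (≤-trans upper (lower W′-resolving)))
      where
      |W| : length Zs ∸ 2 ^ (2 + m) + 1 ≡ length W
      |W| = w+p≡1+z⇒z∸p+1≡w (∈-length (atom∈W {suc zero} λ ())) (≤-antisym upper (lower W-resolving))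

theorem3p20 : (n : ℕ) → 3 ≤ n → (k : Subset n → ℕ) → IsBlowUp n k →
    (Zs : List (BU n k)) → Enumerates Zs →
    IsSdim {n} {k} (length Zs ∸ 2 ^ (n ∸ 1) + 1)
theorem3p20 _ (s≤s (s≤s (s≤s _))) k k≥1 Zs enum = BlowUp≥3.Enumerated.sdim k≥1 Zs enum
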